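{- Let $r,m,s$ be positive integers with $m>r$. Then $\mathrm{SG}((r+2)^m,r^s)=0$ if $r+m$ is even and $=1$ if $r+m$ is odd.
   Context: $((r+2)^m,r^s)$ is the partition with $m$ parts equal to $r+2$ followed by $s$ parts equal to $r$. LCTR: from nonempty $\lambda=(\lambda_1,\dots,\lambda_k)$ one may move to $T(\lambda)=(\lambda_2,\dots,\lambda_k)$ or $L(\lambda)=(\lambda_1-1,\dots,\lambda_k-1)$ (nonpositive entries omitted); $()$ has no moves. $\mathrm{SG}(())=0$, $\mathrm{SG}(\lambda)=\mathrm{mex}\{\mathrm{SG}(L(\lambda)),\mathrm{SG}(T(\lambda))\}$ otherwise, with $\mathrm{mex}(B)$ the least nonnegative integer not in $B$. -}

module Defs where

open import Data.Nat using (ℕ; zero; suc; _+_; _∸_; _≟_)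
open import Data.List using (List; []; _∷_; _++_; replicate; length)
open import Data.Nat.ListAction using (sum)
open import Relation.Nullary using (does)
open import Data.Bool using (true; false; if_then_else_)

-- A partition is a list of (positive) naturals in weakly decreasing order.
Partition : Set
Partition = List ℕ

T : Partition → Partition
T []       = []
T (_ ∷ xs) = xs

L : Partition → Partition
L []            = []
L (zero ∷ xs)    = L xs
L (suc zero ∷ xs) = L xs
L (suc (suc n) ∷ xs) = suc n ∷ L xs

mex2 : ℕ → ℕ → ℕ
mex2 a b with does (a ≟ 0) | does (b ≟ 0)
... | false | false = 0
... | true  | false = if does (b ≟ 1) then 2 else 1
... | false | true  = if does (a ≟ 1) then 2 else 1
... | true  | true  = 1

-- Sprague–Grundy value with fuel; the fuel sum λ + length λ strictly
-- decreases along every move, so it always suffices.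
sgFuel : ℕ → Partition → ℕ
sgFuel _       []         = 0
sgFuel zero    (_ ∷ _)    = 0
sgFuel (suc k) (x ∷ xs)   = mex2 (sgFuel k (L (x ∷ xs))) (sgFuel k (T (x ∷ xs)))

SG : Partition → ℕ
SG xs = sgFuel (sum xs + length xs) xs

block : ℕ → ℕ → ℕ → Partition
block r m s = replicate m (r + 2) ++ replicate s r

-- SG λ = mex {SG (L λ), SG (T λ)} vanishes iff both options are nonzero, and
-- equals 1 iff both vanish.  For 1 ≤ r ≤ m + 1 and s ≥ 1 the position
-- ((r+2)^m, r^s) is therefore a P-position iff r + m is even, by induction on
-- (r, m): L lowers r (down to the base case (2^m), a P-position iff m is even)
-- and T lowers m, each flipping the parity of r + m.  At m = r - 1 the T-option
-- leaves this range, but then the L-option ((r+1)^(r-1), (r-1)^s) is a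
-- P-position.  Once m ≥ r, both options are P-positions or both are not, so the
-- value is 0 or 1 accordingly; in particular the paper's bound m > r can be
-- weakened to m ≥ r.
module Submission where

open import Defs
open import Data.Nat using (ℕ; zero; suc; _+_; _∸_; _%_; _≡ᵇ_; _≤_; _<_; _>_; z≤n; s≤s; s≤s⁻¹)
open import Data.Nat.Properties
  using (+-suc; +-comm; +-assoc; ≤-refl; ≤-reflexive; ≤-trans; <⇒≤; m≤n⇒m≤1+n; m≤n⇒m<n∨m≡n;
         m≤n+m; +-monoʳ-≤)
open import Data.Nat.DivMod using (m%n<n)
open import Data.Nat.ListAction using (sum)
open import Data.List using ([]; _∷_; _++_; replicate; length)
open import Data.List.Properties using (++-identityʳ)
open import Data.Bool using (false)
open import Data.Product using (_×_; _,_)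
open import Data.Sum using ([_,_]′)
open import Relation.Binary.PropositionalEquality
  using (_≡_; refl; sym; trans; cong; cong₂; subst; module ≡-Reasoning)

open ≡-Reasoning

weight : Partition → ℕ
weight []       = 0
weight (x ∷ xs) = suc (x + weight xs)

weight≡sum+length : ∀ xs → weight xs ≡ sum xs + length xs
weight≡sum+length []       = refl
weight≡sum+length (x ∷ xs) = begin
  suc (x + weight xs)               ≡⟨ cong (λ w → suc (x + w)) (weight≡sum+length xs) ⟩
  suc (x + (sum xs + length xs))    ≡⟨ cong suc (+-assoc x (sum xs) (length xs)) ⟨
  suc (x + sum xs + length xs)      ≡⟨ +-suc (x + sum xs) (length xs) ⟨
  x + sum xs + suc (length xs)      ∎

weight-L≤ : ∀ xs → weight (L xs) ≤ weight xs
weight-L≤ []                 = z≤n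
weight-L≤ (zero ∷ xs)        = m≤n⇒m≤1+n (weight-L≤ xs)
weight-L≤ (suc zero ∷ xs)    = m≤n⇒m≤1+n (m≤n⇒m≤1+n (weight-L≤ xs))
weight-L≤ (suc (suc n) ∷ xs) = s≤s (s≤s (m≤n⇒m≤1+n (+-monoʳ-≤ n (weight-L≤ xs))))

weight-L∷≤ : ∀ x xs → weight (L (x ∷ xs)) ≤ x + weight xs
weight-L∷≤ zero          xs = weight-L≤ xs
weight-L∷≤ (suc zero)    xs = m≤n⇒m≤1+n (weight-L≤ xs)
weight-L∷≤ (suc (suc n)) xs = s≤s (s≤s (+-monoʳ-≤ n (weight-L≤ xs)))

sgFuel-stable : ∀ k k′ xs → weight xs ≤ k → weight xs ≤ k′ → sgFuel k xs ≡ sgFuel k′ xs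
sgFuel-stable zero    zero     []       _       _        = refl
sgFuel-stable zero    (suc k′) []       _       _        = refl
sgFuel-stable (suc k) zero     []       _       _        = refl
sgFuel-stable (suc k) (suc k′) []       _       _        = refl
sgFuel-stable (suc k) (suc k′) (x ∷ xs) (s≤s h) (s≤s h′) =
  cong₂ mex2 (sgFuel-stable k k′ (L (x ∷ xs)) (≤-trans (weight-L∷≤ x xs) h) (≤-trans (weight-L∷≤ x xs) h′))
             (sgFuel-stable k k′ xs (≤-trans (m≤n+m _ x) h) (≤-trans (m≤n+m _ x) h′))

SG≡sgFuel : ∀ {k} xs → weight xs ≤ k → SG xs ≡ sgFuel k xs
SG≡sgFuel xs = sgFuel-stable _ _ xs (≤-reflexive (weight≡sum+length xs))

SG-∷ : ∀ x xs → SG (x ∷ xs) ≡ mex2 (SG (L (x ∷ xs))) (SG xs)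
SG-∷ x xs = begin
  SG (x ∷ xs)                                  ≡⟨ SG≡sgFuel (x ∷ xs) ≤-refl ⟩
  mex2 (sgFuel k (L (x ∷ xs))) (sgFuel k xs)   ≡⟨ cong₂ mex2 (SG≡sgFuel (L (x ∷ xs)) (weight-L∷≤ x xs))
                                                              (SG≡sgFuel xs (m≤n+m _ x)) ⟨
  mex2 (SG (L (x ∷ xs))) (SG xs)               ∎
  where k = x + weight xs

%2≤1 : ∀ n → n % 2 ≤ 1
%2≤1 n = s≤s⁻¹ (m%n<n n 2)

%2-suc : ∀ n → suc n % 2 ≡ 1 ∸ n % 2
%2-suc zero          = refl
%2-suc (suc zero)    = refl
%2-suc (suc (suc n)) = %2-suc n

+-self-%2 : ∀ n → (n + n) % 2 ≡ 0
+-self-%2 zero    = refl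
+-self-%2 (suc n) = trans (cong (λ k → suc k % 2) (+-suc n n)) (+-self-%2 n)

suc-+-self-%2 : ∀ n → (suc n + n) % 2 ≡ 1
suc-+-self-%2 n = trans (%2-suc (n + n)) (cong (1 ∸_) (+-self-%2 n))

infix 4 _≈₀_

_≈₀_ : ℕ → ℕ → Set
a ≈₀ b = (a ≡ᵇ 0) ≡ (b ≡ᵇ 0)

≡⇒≈₀ : ∀ {a b} → a ≡ b → a ≈₀ b
≡⇒≈₀ = cong (_≡ᵇ 0)

mex2-≈₀-same : ∀ a b {v} → v ≤ 1 → a ≈₀ v → b ≈₀ v → mex2 a b ≡ 1 ∸ v
mex2-≈₀-same zero    zero    {zero}        _        _  _  = refl
mex2-≈₀-same (suc a) (suc b) {suc zero}    _        _  _  = refl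
mex2-≈₀-same zero    (suc b) {zero}        _        _  ()
mex2-≈₀-same (suc a) _       {zero}        _        () _
mex2-≈₀-same zero    _       {suc _}       _        () _
mex2-≈₀-same (suc a) zero    {suc zero}    _        _  ()
mex2-≈₀-same _       _       {suc (suc _)} (s≤s ()) _  _

mex2-zeroˡ : ∀ a b → a ≈₀ 0 → mex2 a b ≈₀ 1
mex2-zeroˡ zero zero          _ = refl
mex2-zeroˡ zero (suc zero)    _ = refl
mex2-zeroˡ zero (suc (suc b)) _ = refl

mex2-nonzeroˡ : ∀ a b {v} → v ≤ 1 → a ≈₀ 1 → b ≈₀ v → mex2 a b ≈₀ 1 ∸ v
mex2-nonzeroˡ (suc zero)    zero    {zero}        _        _ _  = refl
mex2-nonzeroˡ (suc (suc a)) zero    {zero}        _        _ _  = refl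
mex2-nonzeroˡ (suc a)       (suc b) {suc zero}    _        _ _  = refl
mex2-nonzeroˡ (suc a)       (suc b) {zero}        _        _ ()
mex2-nonzeroˡ (suc a)       zero    {suc zero}    _        _ ()
mex2-nonzeroˡ _             _       {suc (suc _)} (s≤s ()) _ _

L-replicate-1 : ∀ n → L (replicate n 1) ≡ []
L-replicate-1 zero    = refl
L-replicate-1 (suc n) = L-replicate-1 n

L-replicate-++ : ∀ n a xs → L (replicate n (2 + a) ++ xs) ≡ replicate n (1 + a) ++ L xs
L-replicate-++ zero    a xs = refl
L-replicate-++ (suc n) a xs = cong (1 + a ∷_) (L-replicate-++ n a xs)

L-replicate : ∀ n a → L (replicate n (2 + a)) ≡ replicate n (1 + a)
L-replicate zero    a = refl
L-replicate (suc n) a = cong (1 + a ∷_) (L-replicate n a)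

-- The paper's ((r+2)^m, r^s), with the big part written 2 + r so that L can
-- pattern match on it (r + 2 is stuck on the variable r).
block′ : ℕ → ℕ → ℕ → Partition
block′ r m s = replicate m (2 + r) ++ replicate s r

block≡block′ : ∀ r m s → block r m s ≡ block′ r m s
block≡block′ r m s = cong (λ k → replicate m k ++ replicate s r) (+-comm r 2)

L-block′ : ∀ r m s → L (block′ (2 + r) m s) ≡ block′ (1 + r) m s
L-block′ r m s = trans (L-replicate-++ m (2 + r) _) (cong (replicate m (3 + r) ++_) (L-replicate s r))

L-block′-1 : ∀ m s → L (block′ 1 m s) ≡ replicate m 2
L-block′-1 m s = begin
  L (block′ 1 m s)                  ≡⟨ L-replicate-++ m 1 _ ⟩
  replicate m 2 ++ L (replicate s 1) ≡⟨ cong (replicate m 2 ++_) (L-replicate-1 s) ⟩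
  replicate m 2 ++ []               ≡⟨ ++-identityʳ (replicate m 2) ⟩
  replicate m 2                     ∎

SG-replicate-1 : ∀ n → SG (replicate (suc n) 1) ≈₀ 1
SG-replicate-1 n = trans (≡⇒≈₀ (SG-∷ 1 (replicate n 1)))
  (mex2-zeroˡ (SG (L (replicate (suc n) 1))) (SG (replicate n 1)) (≡⇒≈₀ (cong SG (L-replicate-1 n))))

SG-replicate-2 : ∀ n → SG (replicate n 2) ≈₀ n % 2
SG-replicate-2 zero    = refl
SG-replicate-2 (suc n) = begin
  SG (replicate (suc n) 2) ≡ᵇ 0          ≡⟨ ≡⇒≈₀ (SG-∷ 2 (replicate n 2)) ⟩
  mex2 (SG L-option) (SG T-option) ≡ᵇ 0  ≡⟨ mex2-nonzeroˡ (SG L-option) (SG T-option) (%2≤1 n)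
                                              L-option-nonzero (SG-replicate-2 n) ⟩
  1 ∸ n % 2 ≡ᵇ 0                         ≡⟨ ≡⇒≈₀ (%2-suc n) ⟨
  suc n % 2 ≡ᵇ 0                         ∎
  where
  L-option T-option : Partition
  L-option = L (replicate (suc n) 2)
  T-option = replicate n 2
  L-option-nonzero : SG L-option ≈₀ 1
  L-option-nonzero = trans (≡⇒≈₀ (cong SG (L-replicate (suc n) 0))) (SG-replicate-1 n)

SG-block′≈₀%2   : ∀ r m s → r ≤ m → SG (block′ (suc r) m (suc s)) ≈₀ (suc r + m) % 2
SG-block′≡%2    : ∀ r m s → r ≤ m → SG (block′ (suc r) (suc m) (suc s)) ≡ (suc r + suc m) % 2
SG-block′-diagonal≈₀1 : ∀ r s → SG (block′ (suc r) r (suc s)) ≈₀ 1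
SG-L-block′≈₀%2 : ∀ r m s → r ≤ suc m → SG (L (block′ (suc r) (suc m) (suc s))) ≈₀ (suc r + m) % 2

SG-block′≈₀%2 r zero    s z≤n   = SG-block′-diagonal≈₀1 zero s
-- Matching refl on r ≡ suc m would make r a dot pattern and hide from the
-- termination checker that the first index decreases along the diagonal case.
SG-block′≈₀%2 r (suc m) s r≤1+m = [ below-diagonal , on-diagonal ]′ (m≤n⇒m<n∨m≡n r≤1+m)
  where
  below-diagonal : r < suc m → SG (block′ (suc r) (suc m) (suc s)) ≈₀ (suc r + suc m) % 2
  below-diagonal r<1+m = ≡⇒≈₀ (SG-block′≡%2 r m s (s≤s⁻¹ r<1+m))
  on-diagonal : r ≡ suc m → SG (block′ (suc r) (suc m) (suc s)) ≈₀ (suc r + suc m) % 2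
  on-diagonal r≡1+m = subst (λ k → SG (block′ (suc r) k (suc s)) ≈₀ (suc r + k) % 2) r≡1+m
    (trans (SG-block′-diagonal≈₀1 r s) (≡⇒≈₀ (sym (suc-+-self-%2 r))))

SG-block′-diagonal≈₀1 zero    s = SG-replicate-1 s
SG-block′-diagonal≈₀1 (suc r) s = begin
  SG (block′ (2 + r) (suc r) (suc s)) ≡ᵇ 0        ≡⟨ ≡⇒≈₀ (SG-∷ (4 + r) T-option) ⟩
  mex2 (SG L-option) (SG T-option) ≡ᵇ 0           ≡⟨ mex2-zeroˡ (SG L-option) (SG T-option)
                                                       (trans (SG-L-block′≈₀%2 (suc r) r s ≤-refl) (≡⇒≈₀ (+-self-%2 r))) ⟩
  false                                           ∎
  where
  L-option T-option : Partition
  L-option = L (block′ (2 + r) (suc r) (suc s))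
  T-option = block′ (2 + r) r (suc s)

SG-block′≡%2 r m s r≤m = begin
  SG (block′ (suc r) (suc m) (suc s))   ≡⟨ SG-∷ (3 + r) T-option ⟩
  mex2 (SG L-option) (SG T-option)      ≡⟨ mex2-≈₀-same (SG L-option) (SG T-option) (%2≤1 (suc r + m))
                                             (SG-L-block′≈₀%2 r m s (m≤n⇒m≤1+n r≤m)) (SG-block′≈₀%2 r m s r≤m) ⟩
  1 ∸ (suc r + m) % 2                   ≡⟨ %2-suc (suc r + m) ⟨
  suc (suc r + m) % 2                   ≡⟨ cong (_% 2) (+-suc (suc r) m) ⟨
  (suc r + suc m) % 2                   ∎
  where
  L-option T-option : Partition
  L-option = L (block′ (suc r) (suc m) (suc s))
  T-option = block′ (suc r) m (suc s)

SG-L-block′≈₀%2 zero    m s _         = trans (≡⇒≈₀ (cong SG (L-block′-1 (suc m) (suc s)))) (SG-replicate-2 (suc m))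
SG-L-block′≈₀%2 (suc r) m s (s≤s r≤m) = begin
  SG (L (block′ (2 + r) (suc m) (suc s))) ≡ᵇ 0   ≡⟨ ≡⇒≈₀ (cong SG (L-block′ r (suc m) (suc s))) ⟩
  SG (block′ (suc r) (suc m) (suc s)) ≡ᵇ 0       ≡⟨ SG-block′≈₀%2 r (suc m) s (m≤n⇒m≤1+n r≤m) ⟩
  (suc r + suc m) % 2 ≡ᵇ 0                       ≡⟨ ≡⇒≈₀ (cong (_% 2) (+-suc (suc r) m)) ⟩
  (2 + r + m) % 2 ≡ᵇ 0                           ∎

lemma3p14 : (r m s : ℕ) → 0 < r → 0 < m → 0 < s → m > r →
    (((r + m) % 2 ≡ 0) → SG (block r m s) ≡ 0) × (((r + m) % 2 ≡ 1) → SG (block r m s) ≡ 1)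
lemma3p14 (suc r) (suc m) (suc s) _ _ _ (s≤s r<m) =
  (λ even → trans SG≡%2 even) , (λ odd → trans SG≡%2 odd)
  where
  SG≡%2 : SG (block (suc r) (suc m) (suc s)) ≡ (suc r + suc m) % 2
  SG≡%2 = trans (cong SG (block≡block′ (suc r) (suc m) (suc s))) (SG-block′≡%2 r m s (<⇒≤ r<m))
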